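{- Suppose $x,a,b,p$ are primes greater than $3$ with $a\le b$, such that $a^2+a+1$ and $b^2+b+1$ are prime and $$x^2+x+1=(a^2+a+1)(b^2+b+1)p.$$ Then $2b<p$. -}

module Defs where

module Submission where

-- Write Φ₃ n = n² + n + 1, A = Φ₃ a and B = Φ₃ b, so the hypothesis reads
-- Φ₃ x = A·B·p with A, B, p, x, b primes > 3 and a ≤ b.
--
-- A prime > 3 is ≡ 1 or 5 (mod 6), and n ≡ 1 (mod 6) gives
-- 3 ∣ Φ₃ n.  As neither B nor A·B·p is divisible by 3, b ≡ x ≡ 5 (mod 6).
-- Splitting.  Φ₃ x > B forces x = b + c with c > 0, and
-- Φ₃ (b + c) = B + c·(2b + c + 1), so the prime B divides c or 2b + c + 1;
-- write that factor as m·B.  Since B ≡ 1 (mod 6), comparing residues gives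
-- 6 ∣ m, resp. 6 ∣ m + 1, hence m ≥ 5.
-- Cofactor bounds.  With b = a + d and s = 2a + d + 1, in both cases A·p
-- differs from m²·A by a product of positive numbers at most 1 + m·s (by a
-- single such number when a = b in the second case), so the prime A is at
-- most 1 + m·s; on the other hand A·p ≥ m²b².  If p ≤ 2b then m²b² ≤ A·p ≤ 2b·(1 + m(2b + 1)), which fails
-- for m ≥ 5 and b ≥ 3.  Hence 2b < p.

open import Defs
open import Data.Nat using (ℕ; _+_; _*_; _≤_; _<_)
open import Data.Nat.Primality using (Prime)
open import Relation.Binary.PropositionalEquality using (_≡_)

open import Data.Nat using (zero; suc; z≤n; s≤s; NonZero; NonTrivial; _%_; _/_; >-nonZero)
open import Data.Nat.Properties
open import Data.Nat.DivMod using (m≡m%n+[m/n]*n; m%n<n)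
open import Data.Nat.Divisibility
  using (_∣_; divides; _∣0; ∣-refl; ∣-trans; ∣m∣n⇒∣m+n; ∣m+n∣m⇒∣n; m∣m*n; n∣m*n; n∣m*n*o; ∣⇒≤)
open import Data.Nat.Primality using (composite; euclidsLemma; prime?)
open import Data.Nat.Tactic.RingSolver using (solve-∀)
open import Data.Product using (∃-syntax; _×_; _,_)
open import Data.Sum using (_⊎_; inj₁; inj₂)
open import Data.Empty using (⊥-elim)
open import Relation.Nullary using (¬_)
open import Relation.Nullary.Decidable using (from-yes)
open import Relation.Binary.PropositionalEquality using (refl; sym; trans; cong; subst)

Φ₃ : ℕ → ℕ
Φ₃ n = n * n + n + 1

Φ₃-positive : ∀ n → 0 < Φ₃ n
Φ₃-positive n = m≤n+m 1 (n * n + n)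

n≤Φ₃n : ∀ n → n ≤ Φ₃ n
n≤Φ₃n n = ≤-trans (m≤n+m n (n * n)) (m≤m+n (n * n + n) 1)

Φ₃-mono : ∀ {m n} → m ≤ n → Φ₃ m ≤ Φ₃ n
Φ₃-mono m≤n = +-monoˡ-≤ 1 (+-mono-≤ (*-mono-≤ m≤n m≤n) m≤n)

-- Expansion of Φ₃ around b: the increment c·(2b + c + 1) is what B must divide.
Φ₃-shift : ∀ b c → (b + c) * (b + c) + (b + c) + 1 ≡ (b * b + b + 1) + c * (2 * b + c + 1)
Φ₃-shift = solve-∀


prime[3] : Prime 3
prime[3] = from-yes (prime? 3)

prime⇒¬proper-divisor : ∀ {n} d .{{_ : NonTrivial d}} → Prime n → d < n → ¬ d ∣ n
prime⇒¬proper-divisor d pn d<n d∣n = Prime.notComposite pn (composite d<n d∣n)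

prime∤product₃ : ∀ {P u v w} → Prime P → ¬ P ∣ u → ¬ P ∣ v → ¬ P ∣ w → ¬ P ∣ u * v * w
prime∤product₃ {u = u} {v} {w} pP P∤u P∤v P∤w P∣uvw with euclidsLemma (u * v) w pP P∣uvw
... | inj₂ P∣w = P∤w P∣w
... | inj₁ P∣uv with euclidsLemma u v pP P∣uv
...   | inj₁ P∣u = P∤u P∣u
...   | inj₂ P∣v = P∤v P∣v

Φ₃-residue-1 : ∀ q → (1 + q * 6) * (1 + q * 6) + (1 + q * 6) + 1 ≡ (1 + 6 * q + 12 * q * q) * 3
Φ₃-residue-1 = solve-∀

Φ₃-residue-5 : ∀ q → (5 + 6 * q) * (5 + 6 * q) + (5 + 6 * q) + 1 ≡ 1 + 6 * (5 + 11 * q + 6 * q * q)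
Φ₃-residue-5 = solve-∀

-- A prime n > 3 with 3 ∤ Φ₃ n is ≡ 5 (mod 6): the residues 0, 2, 4 make 2 a
-- divisor of n, the residue 3 makes 3 a divisor, and the residue 1 gives 3 ∣ Φ₃ n.
prime-residue-5 : ∀ {n} → Prime n → 3 < n → ¬ 3 ∣ Φ₃ n → ∃[ q ] n ≡ 5 + 6 * q
prime-residue-5 {n} pn 3<n 3∤Φ₃n =
  by-residue (n % 6) (n / 6) (m≡m%n+[m/n]*n n 6) (m%n<n n 6)
  where
  common : ∀ {d r} q → n ≡ r + q * 6 → d ∣ r → d ∣ 6 → d ∣ n
  common q n≡ d∣r d∣6 = subst (_ ∣_) (sym n≡) (∣m∣n⇒∣m+n d∣r (∣-trans d∣6 (n∣m*n q)))

  2∤n : ¬ 2 ∣ n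
  2∤n = prime⇒¬proper-divisor 2 pn (<⇒≤ 3<n)

  3∤n : ¬ 3 ∣ n
  3∤n = prime⇒¬proper-divisor 3 pn 3<n

  by-residue : ∀ r q → n ≡ r + q * 6 → r < 6 → ∃[ q ] n ≡ 5 + 6 * q
  by-residue 0 q n≡ _ = ⊥-elim (2∤n (common q n≡ (2 ∣0) (divides 3 refl)))
  by-residue 1 q n≡ _ =
    ⊥-elim (3∤Φ₃n (divides (1 + 6 * q + 12 * q * q) (trans (cong Φ₃ n≡) (Φ₃-residue-1 q))))
  by-residue 2 q n≡ _ = ⊥-elim (2∤n (common q n≡ ∣-refl (divides 3 refl)))
  by-residue 3 q n≡ _ = ⊥-elim (3∤n (common q n≡ ∣-refl (divides 2 refl)))
  by-residue 4 q n≡ _ = ⊥-elim (2∤n (common q n≡ (divides 2 refl) (divides 3 refl)))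
  by-residue 5 q n≡ _ = q , trans n≡ (cong (5 +_) (*-comm q 6))
  by-residue (suc (suc (suc (suc (suc (suc _)))))) _ _ (s≤s (s≤s (s≤s (s≤s (s≤s (s≤s ()))))))


∣-unit-multiple : ∀ k n t → k ∣ n * (1 + k * t) → k ∣ n
∣-unit-multiple k n t k∣ = ∣m+n∣m⇒∣n (subst (k ∣_) (expand k n t) k∣) (m∣m*n (n * t))
  where
  expand : ∀ k n t → n * (1 + k * t) ≡ k * (n * t) + n
  expand = solve-∀

-- Case c = m·B: if b ≡ x ≡ 5 (mod 6) and x = b + m·Φ₃ b with m ≠ 0, then
-- 6 ∣ m·Φ₃ b, hence 6 ∣ m because Φ₃ b ≡ 1 (mod 6); so m ≥ 6.
multiplier-case₁ : ∀ {b x m q k} → b ≡ 5 + 6 * q → x ≡ 5 + 6 * k →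
                   x ≡ b + m * Φ₃ b → .{{NonZero m}} → 5 ≤ m
multiplier-case₁ {m = m} {q} {k} refl refl x≡ = <⇒≤ (∣⇒≤ 6∣m)
  where
  6∣mB : 6 ∣ m * Φ₃ (5 + 6 * q)
  6∣mB = ∣m+n∣m⇒∣n (divides k (trans (sym (+-cancelˡ-≡ 5 _ _ x≡)) (*-comm 6 k))) (m∣m*n q)

  6∣m : 6 ∣ m
  6∣m = ∣-unit-multiple 6 m (5 + 11 * q + 6 * q * q)
          (subst (λ B → 6 ∣ m * B) (Φ₃-residue-5 q) 6∣mB)

-- Case 2b + c + 1 = m·B: if b ≡ x ≡ 5 (mod 6) and x + b + 1 = m·Φ₃ b, then
-- 6 ∣ (m + 1)·Φ₃ b, hence 6 ∣ m + 1; so m ≥ 5.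
multiplier-case₂ : ∀ {b x m q k} → b ≡ 5 + 6 * q → x ≡ 5 + 6 * k →
                   x + b + 1 ≡ m * Φ₃ b → 5 ≤ m
multiplier-case₂ {m = m} {q} {k} refl refl x+b+1≡ = ≤-pred (∣⇒≤ 6∣1+m)
  where
  B : ℕ
  B = Φ₃ (5 + 6 * q)

  sum-of-residues : ∀ q k → (5 + 6 * q) * (5 + 6 * q) + (5 + 6 * q) + 1 + (5 + 6 * k + (5 + 6 * q) + 1)
                            ≡ (7 + k + 12 * q + 6 * q * q) * 6
  sum-of-residues = solve-∀

  6∣[1+m]B : 6 ∣ suc m * B
  6∣[1+m]B = divides (7 + k + 12 * q + 6 * q * q)
               (trans (cong (B +_) (sym x+b+1≡)) (sum-of-residues q k))

  6∣1+m : 6 ∣ suc m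
  6∣1+m = ∣-unit-multiple 6 (suc m) (5 + 11 * q + 6 * q * q)
            (subst (λ B → 6 ∣ suc m * B) (Φ₃-residue-5 q) 6∣[1+m]B)


prime∣product⇒≤ : ∀ {P u v K} → Prime P → P ∣ u * v → 0 < u → u ≤ K → 0 < v → v ≤ K → P ≤ K
prime∣product⇒≤ {u = u} {v} pP P∣uv 0<u u≤K 0<v v≤K with euclidsLemma u v pP P∣uv
... | inj₁ P∣u = ≤-trans (∣⇒≤ {{>-nonZero 0<u}} P∣u) u≤K
... | inj₂ P∣v = ≤-trans (∣⇒≤ {{>-nonZero 0<v}} P∣v) v≤K

-- The two estimates on A·p valid in either case, for b = a + d and s = 2a + d + 1.
record CofactorBounds (a d p m : ℕ) : Set where
  field
    lower : m * m * ((a + d) * (a + d)) ≤ Φ₃ a * p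
    upper : Φ₃ a ≤ 1 + m * (2 * a + d + 1)

-- Case c = m·B, where A·p = 1 + m(2b + 1 + m·B) = m²·A + (1 + m·d)(1 + m·s).
bounds-case₁ : ∀ a d p m → Prime (Φ₃ a) →
               Φ₃ a * p ≡ 1 + m * (2 * (a + d) + 1 + m * Φ₃ (a + d)) →
               CofactorBounds a d p m
bounds-case₁ a d p m pA Ap≡ = record { lower = lower ; upper = upper }
  where
  split-square : ∀ m b → 1 + m * (2 * b + 1 + m * (b * b + b + 1))
                         ≡ m * m * (b * b) + (1 + m * (2 * b + 1) + m * m * (b + 1))
  split-square = solve-∀

  factorisation : ∀ a d m → 1 + m * (2 * (a + d) + 1 + m * ((a + d) * (a + d) + (a + d) + 1))
                            ≡ m * m * (a * a + a + 1) + (1 + m * d) * (1 + m * (2 * a + d + 1))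
  factorisation = solve-∀

  lower : m * m * ((a + d) * (a + d)) ≤ Φ₃ a * p
  lower = ≤-trans (m≤m+n _ _) (≤-reflexive (sym (trans Ap≡ (split-square m (a + d)))))

  A∣product : Φ₃ a ∣ (1 + m * d) * (1 + m * (2 * a + d + 1))
  A∣product = ∣m+n∣m⇒∣n (subst (Φ₃ a ∣_) (trans Ap≡ (factorisation a d m)) (m∣m*n p))
                         (n∣m*n (m * m))

  d≤s : d ≤ 2 * a + d + 1
  d≤s = ≤-trans (m≤n+m d (2 * a)) (m≤m+n (2 * a + d) 1)

  upper : Φ₃ a ≤ 1 + m * (2 * a + d + 1)
  upper = prime∣product⇒≤ pA A∣product (s≤s z≤n) (+-monoʳ-≤ 1 (*-monoʳ-≤ m d≤s)) (s≤s z≤n) ≤-refl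

-- Case 2b + c + 1 = m·B, where A·p + m(2b + 1) = 1 + m²·B, for m = 2 + i.
-- If a = b, A divides the positive number m·s − 1 = A·m² − A·p; if a < b,
-- then A·p = m²·A + (m·d − 1)(m·s − 1).
upper-case₂ : ∀ a d p i → Prime (Φ₃ a) →
              Φ₃ a * p + (2 + i) * (2 * (a + d) + 1) ≡ 1 + (2 + i) * ((2 + i) * Φ₃ (a + d)) →
              Φ₃ a ≤ 1 + (2 + i) * (2 * a + d + 1)
upper-case₂ a zero p i pA eq =
  ≤-trans (∣⇒≤ {{>-nonZero (s≤s z≤n)}} A∣e) (subst (e ≤_) (sym (e-bound i a)) (m≤n+m e 2))
  where
  -- e = m·s − 1
  e : ℕ
  e = suc i + (2 + i) * (2 * a)

  absorb : ∀ i a X → X + (2 + i) * (2 * (a + 0) + 1) ≡ suc (X + (suc i + (2 + i) * (2 * a)))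
  absorb = solve-∀

  square : ∀ i a → 1 + (2 + i) * ((2 + i) * ((a + 0) * (a + 0) + (a + 0) + 1))
                    ≡ suc ((2 + i) * (2 + i) * (a * a + a + 1))
  square = solve-∀

  e-bound : ∀ i a → 1 + (2 + i) * (2 * a + 0 + 1) ≡ 2 + (suc i + (2 + i) * (2 * a))
  e-bound = solve-∀

  Ap+e≡ : Φ₃ a * p + e ≡ (2 + i) * (2 + i) * Φ₃ a
  Ap+e≡ = suc-injective (trans (sym (absorb i a (Φ₃ a * p))) (trans eq (square i a)))

  A∣e : Φ₃ a ∣ e
  A∣e = ∣m+n∣m⇒∣n (subst (Φ₃ a ∣_) (sym Ap+e≡) (n∣m*n ((2 + i) * (2 + i)))) (m∣m*n p)
upper-case₂ a (suc d) p i pA eq =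
  prime∣product⇒≤ pA A∣uv (s≤s z≤n) (≤-trans u≤v v≤K) (s≤s z≤n) v≤K
  where
  -- u = m·d − 1 and v = m·s − 1
  u v : ℕ
  u = suc i + (2 + i) * d
  v = suc i + (2 + i) * (2 * a + suc d)

  factorisation : ∀ a d i →
    (suc i + (2 + i) * d) * (suc i + (2 + i) * (2 * a + suc d)) + (2 + i) * (2 + i) * (a * a + a + 1)
      + (2 + i) * (2 * (a + suc d) + 1)
    ≡ 1 + (2 + i) * ((2 + i) * ((a + suc d) * (a + suc d) + (a + suc d) + 1))
  factorisation = solve-∀

  v-bound : ∀ i a d → 1 + (2 + i) * (2 * a + suc d + 1)
                      ≡ 2 + (suc i + (2 + i) * (2 * a + suc d))
  v-bound = solve-∀

  Ap≡ : Φ₃ a * p ≡ u * v + (2 + i) * (2 + i) * Φ₃ a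
  Ap≡ = +-cancelʳ-≡ _ _ _ (trans eq (sym (factorisation a d i)))

  A∣uv : Φ₃ a ∣ u * v
  A∣uv = ∣m+n∣m⇒∣n (subst (Φ₃ a ∣_) (trans Ap≡ (+-comm (u * v) _)) (m∣m*n p))
                    (n∣m*n ((2 + i) * (2 + i)))

  u≤v : u ≤ v
  u≤v = +-monoʳ-≤ (suc i) (*-monoʳ-≤ (2 + i) (≤-trans (n≤1+n d) (m≤n+m (suc d) (2 * a))))

  v≤K : v ≤ 1 + (2 + i) * (2 * a + suc d + 1)
  v≤K = subst (v ≤_) (sym (v-bound i a d)) (m≤n+m v 2)

bounds-case₂ : ∀ a d p m → Prime (Φ₃ a) → 2 ≤ m →
               Φ₃ a * p + m * (2 * (a + d) + 1) ≡ 1 + m * (m * Φ₃ (a + d)) →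
               CofactorBounds a d p m
bounds-case₂ a d p (suc (suc i)) pA (s≤s (s≤s _)) eq =
  record { lower = lower ; upper = upper-case₂ a d p i pA eq }
  where
  split-square : ∀ i b → 1 + (2 + i) * ((2 + i) * (b * b + b + 1))
    ≡ ((2 + i) * (2 + i) * (b * b) + (1 + (2 + i) * b * i + (2 + i) * (1 + i)))
      + (2 + i) * (2 * b + 1)
  split-square = solve-∀

  lower : (2 + i) * (2 + i) * ((a + d) * (a + d)) ≤ Φ₃ a * p
  lower = ≤-trans (m≤m+n _ _)
            (≤-reflexive (sym (+-cancelʳ-≡ _ _ _ (trans eq (split-square i (a + d))))))

-- If p ≤ 2b, then m²b² ≤ A·p ≤ 2b(1 + m(2b + 1)), impossible for m ≥ 5, b ≥ 3.
key-inequality : ∀ {m b} → 5 ≤ m → 3 ≤ b → (1 + m * (2 * b + 1)) * (2 * b) < m * m * (b * b)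
key-inequality 5≤m 3≤b with m≤n⇒∃[o]m+o≡n 5≤m | m≤n⇒∃[o]m+o≡n 3≤b
... | i , refl | j , refl = <-≤-trans (m<m+n _ (s≤s z≤n)) (≤-reflexive (sym (expand i j)))
  where
  expand : ∀ i j → (5 + i) * (5 + i) * ((3 + j) * (3 + j))
    ≡ (1 + (5 + i) * (2 * (3 + j) + 1)) * (2 * (3 + j))
      + (3 + j) * (3 + 5 * j + 16 * i + 6 * i * j + 3 * i * i + i * i * j)
  expand = solve-∀

bounds⇒2b<p : ∀ {a d p m} → 5 ≤ m → 3 ≤ a + d → CofactorBounds a d p m → 2 * (a + d) < p
bounds⇒2b<p {a} {d} {p} {m} 5≤m 3≤b bounds = ≰⇒> λ p≤2b → <⇒≱ (Ap<m²b² p≤2b) lower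
  where
  open CofactorBounds bounds
  open ≤-Reasoning

  s≤2b+1 : 2 * a + d + 1 ≤ 2 * (a + d) + 1
  s≤2b+1 = +-monoˡ-≤ 1 (≤-trans (+-monoʳ-≤ (2 * a) (m≤n*m d 2))
                                (≤-reflexive (sym (*-distribˡ-+ 2 a d))))

  Ap<m²b² : p ≤ 2 * (a + d) → Φ₃ a * p < m * m * ((a + d) * (a + d))
  Ap<m²b² p≤2b = begin-strict
    Φ₃ a * p                                    ≤⟨ *-monoʳ-≤ (Φ₃ a) p≤2b ⟩
    Φ₃ a * (2 * (a + d))                        ≤⟨ *-monoˡ-≤ (2 * (a + d)) upper ⟩
    (1 + m * (2 * a + d + 1)) * (2 * (a + d))   ≤⟨ *-monoˡ-≤ (2 * (a + d))
                                                     (+-monoʳ-≤ 1 (*-monoʳ-≤ m s≤2b+1)) ⟩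
    (1 + m * (2 * (a + d) + 1)) * (2 * (a + d)) <⟨ key-inequality 5≤m 3≤b ⟩
    m * m * ((a + d) * (a + d))                 ∎


Φ₃-multiple⇒larger : ∀ {x b A p} → 0 < A → 1 < p → Φ₃ x ≡ A * Φ₃ b * p → b < x
Φ₃-multiple⇒larger {x} {b} {A} {p} 0<A 1<p eq =
  ≰⇒> λ x≤b → <-irrefl eq (≤-<-trans (Φ₃-mono x≤b) B<ABp)
  where
  B<ABp : Φ₃ b < A * Φ₃ b * p
  B<ABp = <-≤-trans (m<m*n (Φ₃ b) p {{>-nonZero (Φ₃-positive b)}} 1<p)
                    (*-monoˡ-≤ p (m≤n*m (Φ₃ b) A {{>-nonZero 0<A}}))

gap : ∀ {b x} → b < x → ∃[ c ] 0 < c × x ≡ b + c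
gap {b} b<x with m≤n⇒∃[o]m+o≡n b<x
... | c , refl = suc c , s≤s z≤n , sym (+-suc b c)

Φ₃-divisor-split : ∀ {b c} → Prime (Φ₃ b) → Φ₃ b ∣ Φ₃ (b + c) → Φ₃ b ∣ c ⊎ Φ₃ b ∣ 2 * b + c + 1
Φ₃-divisor-split {b} {c} pB B∣ =
  euclidsLemma c (2 * b + c + 1) pB (∣m+n∣m⇒∣n (subst (Φ₃ b ∣_) (Φ₃-shift b c) B∣) ∣-refl)

cancel-middle : ∀ {A B p r} → 0 < B → A * B * p ≡ B * r → A * p ≡ r
cancel-middle {A} {B} {p} {r} 0<B eq =
  *-cancelˡ-≡ _ _ B {{>-nonZero 0<B}} (trans (sym (regroup A B p)) eq)
  where
  regroup : ∀ A B p → A * B * p ≡ B * (A * p)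
  regroup = solve-∀

cofactor-bounds : ∀ {a d c p q k} → Prime (Φ₃ a) → Prime (Φ₃ (a + d)) → 0 < c →
                  a + d ≡ 5 + 6 * q → a + d + c ≡ 5 + 6 * k →
                  Φ₃ (a + d + c) ≡ Φ₃ a * Φ₃ (a + d) * p →
                  ∃[ m ] 5 ≤ m × CofactorBounds a d p m
cofactor-bounds {a} {d} {c} {p} {q} {k} pA pB 0<c b≡ x≡ eq
  with Φ₃-divisor-split {a + d} {c} pB (subst (Φ₃ (a + d) ∣_) (sym eq) (n∣m*n*o (Φ₃ a) p))
... | inj₁ (divides m refl) = m , 5≤m , bounds-case₁ a d p m pA Ap≡
  where
  b B : ℕ
  b = a + d
  B = Φ₃ b

  shift-by-multiple : ∀ b m → let B = b * b + b + 1 in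
                      (b + m * B) * (b + m * B) + (b + m * B) + 1 ≡ B * (1 + m * (2 * b + 1 + m * B))
  shift-by-multiple = solve-∀

  Ap≡ : Φ₃ a * p ≡ 1 + m * (2 * b + 1 + m * B)
  Ap≡ = cancel-middle {Φ₃ a} {B} {p} (Φ₃-positive b) (trans (sym eq) (shift-by-multiple b m))

  5≤m : 5 ≤ m
  5≤m = multiplier-case₁ {q = q} {k} b≡ x≡ refl {{m*n≢0⇒m≢0 m {{>-nonZero 0<c}}}}
... | inj₂ (divides m e) = m , 5≤m , bounds-case₂ a d p m pA (≤-trans (s≤s (s≤s z≤n)) 5≤m) H
  where
  b B : ℕ
  b = a + d
  B = Φ₃ b

  increment : ∀ B c m → B + c * (m * B) ≡ B * (1 + c * m)
  increment = solve-∀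

  collect : ∀ b c m → 1 + c * m + m * (2 * b + 1) ≡ 1 + m * (2 * b + c + 1)
  collect = solve-∀

  twice-b : ∀ b c → b + c + b + 1 ≡ 2 * b + c + 1
  twice-b = solve-∀

  Ap≡ : Φ₃ a * p ≡ 1 + c * m
  Ap≡ = cancel-middle {Φ₃ a} {B} {p} (Φ₃-positive b)
          (trans (sym eq) (trans (Φ₃-shift b c) (trans (cong (λ t → B + c * t) e) (increment B c m))))

  H : Φ₃ a * p + m * (2 * b + 1) ≡ 1 + m * (m * B)
  H = trans (cong (_+ m * (2 * b + 1)) Ap≡) (trans (collect b c m) (cong (λ t → 1 + m * t) e))

  5≤m : 5 ≤ m
  5≤m = multiplier-case₂ {q = q} {k} b≡ x≡ (trans (twice-b b c) e)


lemma11 : (x a b p : ℕ) → Prime x → Prime a → Prime b → Prime p →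
    3 < x → 3 < a → 3 < b → 3 < p → a ≤ b →
    Prime (a * a + a + 1) → Prime (b * b + b + 1) →
    x * x + x + 1 ≡ (a * a + a + 1) * (b * b + b + 1) * p →
    2 * b < p
lemma11 x a b p px _ pb pp 3<x 3<a 3<b 3<p a≤b pA pB eq
  with m≤n⇒∃[o]m+o≡n a≤b
... | d , refl
  with gap (Φ₃-multiple⇒larger {x} {a + d} (Φ₃-positive a) (<-trans (s≤s (s≤s z≤n)) 3<p) eq)
...   | c , 0<c , refl =
  let q , b≡ = prime-residue-5 pb 3<b 3∤B
      k , x≡ = prime-residue-5 px 3<x 3∤Φ₃x
      m , 5≤m , bounds = cofactor-bounds {a} {d} {c} {p} {q} {k} pA pB 0<c b≡ x≡ eq
  in bounds⇒2b<p {a} {d} 5≤m (<⇒≤ 3<b) bounds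
  where
  3∤ : ∀ {n} → Prime n → 3 < n → ¬ 3 ∣ n
  3∤ pn = prime⇒¬proper-divisor 3 pn

  3∤A : ¬ 3 ∣ Φ₃ a
  3∤A = 3∤ pA (<-≤-trans 3<a (n≤Φ₃n a))
  3∤B : ¬ 3 ∣ Φ₃ (a + d)
  3∤B = 3∤ pB (<-≤-trans 3<b (n≤Φ₃n (a + d)))

  3∤Φ₃x : ¬ 3 ∣ Φ₃ (a + d + c)
  3∤Φ₃x 3∣Φ₃x = prime∤product₃ prime[3] 3∤A 3∤B (3∤ pp 3<p) (subst (3 ∣_) eq 3∣Φ₃x)
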